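{- For every $0\le j\le n-1$, the type of the canonical parabolic of $x_j$ and the type of the canonical parabolic of $x_{2n-1-j}$ are both equal to $\Delta\setminus\{\alpha_1,\dots,\alpha_{j+1}\}$.
   Context: $n\ge1$; $V=\mathbb F_p^{2n+1}$ with symmetric form of matrix $J$ (antidiagonal with entries $1$); $G=\mathrm{SO}(V)\subseteq\mathrm{SL}_{2n+1}$ over $\mathbb F_p$; $B$ = lower triangular matrices in $G$, $T$ = diagonal matrices $\mathrm{diag}(x_1,\dots,x_n,1,x_n^{ -1},\dots,x_1^{ -1})$, $X^*(T)=\mathbb Z^n$ with basis $e_i$; simple roots $\alpha_i=e_i-e_{i+1}$ ($1\le i\le n-1$), $\alpha_n=e_n$; $s_i=s_{\alpha_i}$. Cocharacter $\mu(x)=\mathrm{diag}(x,1,\dots,1,x^{ -1})$; the Hodge parabolic $P$ has type $I=\Delta\setminus\{\alpha_1\}$; $z=w_{0,I}w_0$. The set ${}^IW$ (minimal length representatives of $W_I\backslash W$) is $\{x_0,\dots,x_{2n-1}\}$ with $x_{2n-1}=1$, $x_{2n-1-i}=s_1\cdots s_i$ for $1\le i\le n$, and $x_i=s_1\cdots s_{n-1}s_ns_{n-1}\cdots s_{i+1}$ for $0\le i\le n-2$. For $w\in{}^IW$, the canonical parabolic is the standard parabolic (containing $B$) of type $I_w=\bigcap_{m\ge0}\varphi_w^m(I)$ where $\varphi_w(\beta)=(wz^{ -1})\cdot\beta$ (the Frobenius acts trivially here). -}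

module Defs where

open import Data.Nat as ℕ using (ℕ; zero; suc; _∸_; _≤_; _<_)
open import Data.Nat.Properties using (_≟_)
open import Data.Integer as ℤ using (ℤ; 0ℤ; 1ℤ; -1ℤ)
open import Data.Fin using (Fin; toℕ)
open import Data.Vec using (Vec; tabulate; zipWith; foldr; map)
open import Data.List using (List; []; _∷_; _++_; reverse; upTo; downFrom; concat; replicate)
open import Data.Product using (∃; _×_)
open import Relation.Nullary.Decidable using (does)
open import Data.Bool using (if_then_else_)
open import Relation.Binary.PropositionalEquality using (_≡_)

-- Characters of the maximal torus of SO_{2n+1}: X*(T) = ℤ^n.
-- Coordinate c : Fin n corresponds to the basis vector e_{toℕ c + 1}.
Char : ℕ → Set
Char n = Vec ℤ n

-- e_i (1-based index i; the zero vector if i is out of range)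
e : (n i : ℕ) → Char n
e n i = tabulate λ (c : Fin n) → if does (suc (toℕ c) ≟ i) then 1ℤ else 0ℤ

_+ᶜ_ : ∀ {n} → Char n → Char n → Char n
_+ᶜ_ = zipWith ℤ._+_

_·ᶜ_ : ∀ {n} → ℤ → Char n → Char n
k ·ᶜ v = map (k ℤ.*_) v

-ᶜ_ : ∀ {n} → Char n → Char n
-ᶜ v = map ℤ.-_ v

⟨_,_⟩ : ∀ {n} → Char n → Char n → ℤ
⟨ u , v ⟩ = foldr _ ℤ._+_ 0ℤ (zipWith ℤ._*_ u v)

α : (n i : ℕ) → Char n
α n i = if does (i ≟ n) then e n n else (e n i +ᶜ (-ᶜ e n (suc i)))

α∨ : (n i : ℕ) → Char n
α∨ n i = if does (i ≟ n) then (ℤ.+ 2) ·ᶜ e n n else (e n i +ᶜ (-ᶜ e n (suc i)))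

s : (n i : ℕ) → Char n → Char n
s n i v = v +ᶜ (-ᶜ (⟨ v , α∨ n i ⟩ ·ᶜ α n i))

-- Weyl group elements as words in the simple reflections (1-based indices);
-- the word i₁ ∷ i₂ ∷ … ∷ i_k stands for s_{i₁} s_{i₂} ⋯ s_{i_k}.
Word : Set
Word = List ℕ

act : (n : ℕ) → Word → Char n → Char n
act n [] v = v
act n (i ∷ w) v = s n i (act n w v)

-- inverse of a word (simple reflections are involutions)
inv : Word → Word
inv = reverse

-- s_a s_{a+1} ⋯ s_b  for a ≤ b  (list of indices a..b)
ascending : ℕ → ℕ → Word
ascending a b = Data.List.map (λ k → a ℕ.+ k) (upTo (suc b ∸ a))

descending : ℕ → ℕ → Word
descending a b = reverse (ascending a b)

w₀ : ℕ → Word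
w₀ n = concat (replicate n (ascending 1 n))

-- longest element of W_I, I = Δ ∖ {α_1} (type B_{n-1}):  w_{0,I} = (s_2 ⋯ s_n)^{n-1}
w₀I : ℕ → Word
w₀I n = concat (replicate (n ∸ 1) (ascending 2 n))

zW : ℕ → Word
zW n = w₀I n ++ w₀ n

-- the elements x_0, …, x_{2n-1} of ^I W:
--   x_i = s_1 ⋯ s_{n-1} s_n s_{n-1} ⋯ s_{i+1}   (0 ≤ i ≤ n-2)
--   x_{2n-1-i} = s_1 ⋯ s_i                       (0 ≤ i ≤ n)
x : (n j : ℕ) → Word
x n j = if does (suc j Data.Nat.<? n)
          then ascending 1 n ++ descending (suc j) (n ∸ 1)
          else ascending 1 ((2 ℕ.* n ∸ 1) ∸ j)
  where import Data.Nat

InI : ℕ → ℕ → Set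
InI n i = 2 ≤ i × i ≤ n

φ : (n : ℕ) → Word → Char n → Char n
φ n w = act n (w ++ inv (zW n))

iter : ∀ {A : Set} → ℕ → (A → A) → A → A
iter zero f a = a
iter (suc m) f a = f (iter m f a)

-- α_i ∈ I_w = ⋂_{m ≥ 0} φ_w^m(I)   (i.e. α_i lies in the type of the canonical parabolic of w)
InIw : (n : ℕ) → Word → ℕ → Set
InIw n w i = ∀ (m : ℕ) → ∃ λ k → InI n k × iter m (φ n w) (α n k) ≡ α n i

{-# OPTIONS --safe #-}
-- The Weyl group of type B_n acts on X*(T) = ℤⁿ by signed permutations: s_i (i < n) swaps
-- the coordinates i and i+1, and s_n negates the last one. Hence z⁻¹ = w₀ w_{0,I} negates
-- the first coordinate, and each of x_j, x_{2n-1-j} moves coordinate j+1 to the front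
-- (x_j with a sign) while shifting coordinates 1, …, j one place to the right. So φ = x z⁻¹
-- fixes every vector supported on the coordinates ≥ j+2, in particular α_i for i > j+1.
-- Conversely, every α_k with k ≥ 2 vanishes at coordinate 1, so φ^m(α_k) vanishes at
-- coordinate m+1 for m ≤ j, whereas α_i has entry 1 at coordinate i; for i ≤ j+1 the
-- choice m = i-1 shows that α_i is not in the image of I under φ^m.
module Submission where

open import Defs
open import Data.Nat using (ℕ; zero; suc; _≤_; _<_; _+_; _*_; _∸_; s≤s; z≤n)
import Data.Nat.Properties as ℕ
open import Data.Integer as ℤ using (ℤ; 0ℤ; 1ℤ; -1ℤ)
open import Data.Integer.Properties using (*-zeroʳ; +-identityˡ; +-identityʳ; neg-involutive)
open import Data.Integer.Tactic.RingSolver using (solve-∀)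
open import Data.Vec as Vec using ([]; _∷_; toList; tabulate; zipWith)
open import Data.Vec.Properties using (toList-injective; length-toList)
open import Data.Vec.Relation.Binary.Equality.Cast using (cast-is-id)
open import Data.List using (List; []; _∷_; _++_; [_]; length; foldr; foldl; map; concat; replicate; applyUpTo)
open import Data.List.Properties
  using (++-assoc; ++-identityʳ; length-++; length-map; length-replicate; foldr-++; foldl-++; reverse-foldr;
         map-upTo; map-∘; map-cong; map-id)
open import Data.Product using (∃; _×_; _,_)
open import Data.Sum using (inj₁; inj₂)
open import Data.Empty using (⊥-elim)
open import Function using (flip; _∘_; _⇔_; mk⇔)
open import Relation.Nullary using (yes; no; ¬_)
open import Relation.Nullary.Decidable using (dec-true; dec-false)
open import Relation.Binary.PropositionalEquality
  using (_≡_; _≢_; refl; sym; trans; cong; cong₂; subst; module ≡-Reasoning)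
open ≡-Reasoning

-- Index 0 is not a simple reflection; its clause is what  s n 0  computes (it zeroes the
-- first coordinate), so that toList-s needs no range hypothesis on the index.
reflect : ℕ → List ℤ → List ℤ
reflect _             []            = []
reflect zero          (a ∷ l)       = 0ℤ ∷ l
reflect (suc zero)    (a ∷ [])      = ℤ.- a ∷ []
reflect (suc zero)    (a ∷ b ∷ l)   = b ∷ a ∷ l
reflect (suc (suc i)) (a ∷ l)       = a ∷ reflect (suc i) l

0ᶜ : (n : ℕ) → Char n
0ᶜ n = Vec.replicate n 0ℤ

zeros-minus-zeros : ∀ n → zipWith ℤ._+_ (tabulate {n = n} λ _ → 0ℤ) (Vec.map ℤ.-_ (tabulate λ _ → 0ℤ)) ≡ 0ᶜ n
zeros-minus-zeros zero    = refl
zeros-minus-zeros (suc n) = cong (0ℤ ∷_) (zeros-minus-zeros n)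

α-zero : ∀ n → α (suc n) 0 ≡ -1ℤ ∷ 0ᶜ n
α-zero n = cong (-1ℤ ∷_) (zeros-minus-zeros n)

α∨-zero : ∀ n → α∨ (suc n) 0 ≡ -1ℤ ∷ 0ᶜ n
α∨-zero = α-zero

α-one : ∀ n → α (suc (suc n)) 1 ≡ 1ℤ ∷ -1ℤ ∷ 0ᶜ n
α-one n = cong (λ v → 1ℤ ∷ -1ℤ ∷ v) (zeros-minus-zeros n)

α∨-one : ∀ n → α∨ (suc (suc n)) 1 ≡ 1ℤ ∷ -1ℤ ∷ 0ᶜ n
α∨-one = α-one

α-suc : ∀ n i → α (suc n) (suc (suc i)) ≡ 0ℤ ∷ α n (suc i)
α-suc n i with suc i ℕ.≟ n
... | yes refl rewrite dec-true (i ℕ.≟ i) refl = refl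
... | no i≢n   rewrite dec-false (suc i ℕ.≟ n) i≢n = refl

α∨-suc : ∀ n i → α∨ (suc n) (suc (suc i)) ≡ 0ℤ ∷ α∨ n (suc i)
α∨-suc n i with suc i ℕ.≟ n
... | yes refl rewrite dec-true (i ℕ.≟ i) refl = refl
... | no i≢n   rewrite dec-false (suc i ℕ.≟ n) i≢n = refl

pairing-0ᶜ : ∀ {n} (v : Char n) → ⟨ v , 0ᶜ n ⟩ ≡ 0ℤ
pairing-0ᶜ []      = refl
pairing-0ᶜ (a ∷ v) rewrite pairing-0ᶜ v | *-zeroʳ a = refl

minus-multiple-0ᶜ : ∀ {n} (k : ℤ) (v : Char n) → v +ᶜ (-ᶜ (k ·ᶜ 0ᶜ n)) ≡ v
minus-multiple-0ᶜ k []      = refl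
minus-multiple-0ᶜ k (a ∷ v) rewrite *-zeroʳ k | +-identityʳ a = cong (a ∷_) (minus-multiple-0ᶜ k v)

s-unfold : ∀ n i {c r : Char n} (v : Char n) → α∨ n i ≡ c → α n i ≡ r →
  s n i v ≡ v +ᶜ (-ᶜ (⟨ v , c ⟩ ·ᶜ r))
s-unfold n i v refl refl = refl

s-zero : ∀ n a (v : Char n) → s (suc n) 0 (a ∷ v) ≡ 0ℤ ∷ v
s-zero n a v = trans (s-unfold (suc n) 0 (a ∷ v) (α∨-zero n) (α-zero n))
                     (cong₂ _∷_ head (minus-multiple-0ᶜ ⟨ a ∷ v , -1ℤ ∷ 0ᶜ n ⟩ v))
  where
  head : a ℤ.+ ℤ.- (⟨ a ∷ v , -1ℤ ∷ 0ᶜ n ⟩ ℤ.* -1ℤ) ≡ 0ℤ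
  head rewrite pairing-0ᶜ v = ring a
    where
    ring : ∀ a → a ℤ.+ ℤ.- ((a ℤ.* -1ℤ ℤ.+ 0ℤ) ℤ.* -1ℤ) ≡ 0ℤ
    ring = solve-∀

s-swap : ∀ n a b (v : Char n) → s (suc (suc n)) 1 (a ∷ b ∷ v) ≡ b ∷ a ∷ v
s-swap n a b v = trans (s-unfold (suc (suc n)) 1 (a ∷ b ∷ v) (α∨-one n) (α-one n))
                       (cong₂ _∷_ first (cong₂ _∷_ second (minus-multiple-0ᶜ ⟨ a ∷ b ∷ v , r ⟩ v)))
  where
  r = 1ℤ ∷ -1ℤ ∷ 0ᶜ n
  first : a ℤ.+ ℤ.- (⟨ a ∷ b ∷ v , r ⟩ ℤ.* 1ℤ) ≡ b
  first rewrite pairing-0ᶜ v = ring a b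
    where
    ring : ∀ a b → a ℤ.+ ℤ.- ((a ℤ.* 1ℤ ℤ.+ (b ℤ.* -1ℤ ℤ.+ 0ℤ)) ℤ.* 1ℤ) ≡ b
    ring = solve-∀
  second : b ℤ.+ ℤ.- (⟨ a ∷ b ∷ v , r ⟩ ℤ.* -1ℤ) ≡ a
  second rewrite pairing-0ᶜ v = ring a b
    where
    ring : ∀ a b → b ℤ.+ ℤ.- ((a ℤ.* 1ℤ ℤ.+ (b ℤ.* -1ℤ ℤ.+ 0ℤ)) ℤ.* -1ℤ) ≡ a
    ring = solve-∀

s-negate : ∀ a → s 1 1 (a ∷ []) ≡ ℤ.- a ∷ []
s-negate a = cong (_∷ []) (ring a)
  where
  ring : ∀ a → a ℤ.+ ℤ.- ((a ℤ.* ℤ.+ 2 ℤ.+ 0ℤ) ℤ.* 1ℤ) ≡ ℤ.- a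
  ring = solve-∀

s-cons : ∀ n i a (v : Char n) → s (suc n) (suc (suc i)) (a ∷ v) ≡ a ∷ s n (suc i) v
s-cons n i a v = trans (s-unfold (suc n) (suc (suc i)) (a ∷ v) (α∨-suc n i) (α-suc n i))
                       (step (α∨ n (suc i)) (α n (suc i)))
  where
  step : ∀ c r → (a ∷ v) +ᶜ (-ᶜ (⟨ a ∷ v , 0ℤ ∷ c ⟩ ·ᶜ (0ℤ ∷ r))) ≡ a ∷ (v +ᶜ (-ᶜ (⟨ v , c ⟩ ·ᶜ r)))
  step c r rewrite *-zeroʳ a | +-identityˡ ⟨ v , c ⟩ | *-zeroʳ ⟨ v , c ⟩ | +-identityʳ a = refl

toList-s : ∀ n i (v : Char n) → toList (s n i v) ≡ reflect i (toList v)
toList-s zero i [] = cong toList (s-unfold 0 i [] (empty (α∨ 0 i)) (empty (α 0 i)))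
  where
  empty : (u : Char 0) → u ≡ []
  empty [] = refl
toList-s (suc n)        zero          (a ∷ v)     = cong toList (s-zero n a v)
toList-s (suc zero)     (suc zero)    (a ∷ [])    = cong toList (s-negate a)
toList-s (suc (suc n))  (suc zero)    (a ∷ b ∷ v) = cong toList (s-swap n a b v)
toList-s (suc n)        (suc (suc i)) (a ∷ v)     =
  trans (cong toList (s-cons n i a v)) (cong (a ∷_) (toList-s n (suc i) v))

actᴸ : Word → List ℤ → List ℤ
actᴸ w l = foldr reflect l w

actᴸ⁻¹ : Word → List ℤ → List ℤ
actᴸ⁻¹ w l = foldl (flip reflect) l w

toList-act : ∀ n w (v : Char n) → toList (act n w v) ≡ actᴸ w (toList v)
toList-act n []      v = refl
toList-act n (i ∷ w) v = trans (toList-s n i (act n w v)) (cong (reflect i) (toList-act n w v))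

actᴸ-inv : ∀ w l → actᴸ (inv w) l ≡ actᴸ⁻¹ w l
actᴸ-inv w l = reverse-foldr reflect l w

asc : ℕ → ℕ → Word
asc a zero    = []
asc a (suc k) = a ∷ asc (suc a) k

applyUpTo≡asc : ∀ a k (f : ℕ → ℕ) → (∀ y → f y ≡ a + y) → applyUpTo f k ≡ asc a k
applyUpTo≡asc a zero    f f≗ = refl
applyUpTo≡asc a (suc k) f f≗ =
  cong₂ _∷_ (trans (f≗ 0) (ℕ.+-identityʳ a))
            (applyUpTo≡asc (suc a) k (f ∘ suc) λ y → trans (f≗ (suc y)) (ℕ.+-suc a y))

ascending≡asc : ∀ a b → ascending a b ≡ asc a (suc b ∸ a)
ascending≡asc a b = trans (map-upTo (a +_) _) (applyUpTo≡asc a _ (a +_) λ _ → refl)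

asc-∷ʳ : ∀ a k → asc a (suc k) ≡ asc a k ++ [ a + k ]
asc-∷ʳ a zero    = cong [_] (sym (ℕ.+-identityʳ a))
asc-∷ʳ a (suc k) =
  cong (a ∷_) (trans (asc-∷ʳ (suc a) k) (cong (λ m → asc (suc a) k ++ [ m ]) (sym (ℕ.+-suc a k))))

length-∷ʳ : ∀ (l : List ℤ) y → length (l ++ [ y ]) ≡ suc (length l)
length-∷ʳ []      y = refl
length-∷ʳ (x ∷ l) y = cong suc (length-∷ʳ l y)

reflect-++ : ∀ {j} p l → length p ≡ j → reflect (suc j) (p ++ l) ≡ p ++ reflect 1 l
reflect-++ []      l refl = refl
reflect-++ (a ∷ p) l refl = cong (a ∷_) (reflect-++ p l refl)

actᴸ⁻¹-asc-bubble : ∀ {j} p b t → length p ≡ j →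
  actᴸ⁻¹ (asc (suc j) (length t)) (p ++ b ∷ t) ≡ p ++ t ++ [ b ]
actᴸ⁻¹-asc-bubble p b [] _ = refl
actᴸ⁻¹-asc-bubble {j} p b (c ∷ t) |p| = begin
  actᴸ⁻¹ W (reflect (suc j) (p ++ b ∷ c ∷ t))  ≡⟨ cong (actᴸ⁻¹ W) (reflect-++ p (b ∷ c ∷ t) |p|) ⟩
  actᴸ⁻¹ W (p ++ c ∷ b ∷ t)                    ≡⟨ cong (actᴸ⁻¹ W) (++-assoc p [ c ] (b ∷ t)) ⟨
  actᴸ⁻¹ W ((p ++ [ c ]) ++ b ∷ t)             ≡⟨ actᴸ⁻¹-asc-bubble (p ++ [ c ]) b t |p++c| ⟩
  (p ++ [ c ]) ++ t ++ [ b ]                   ≡⟨ ++-assoc p [ c ] _ ⟩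
  p ++ c ∷ t ++ [ b ]                          ∎
  where
  W = asc (suc (suc j)) (length t)
  |p++c| = trans (length-∷ʳ p c) (cong suc |p|)

actᴸ⁻¹-asc-rotate : ∀ {j} p a t → length p ≡ j →
  actᴸ⁻¹ (asc (suc j) (suc (length t))) (p ++ a ∷ t) ≡ p ++ t ++ [ ℤ.- a ]
actᴸ⁻¹-asc-rotate {j} p a t |p| = begin
  actᴸ⁻¹ (asc (suc j) (suc (length t))) (p ++ a ∷ t)
    ≡⟨ cong (λ u → actᴸ⁻¹ u (p ++ a ∷ t)) (asc-∷ʳ (suc j) (length t)) ⟩
  actᴸ⁻¹ (W ++ [ suc j + length t ]) (p ++ a ∷ t)
    ≡⟨ foldl-++ (flip reflect) (p ++ a ∷ t) W _ ⟩
  reflect (suc (j + length t)) (actᴸ⁻¹ W (p ++ a ∷ t))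
    ≡⟨ cong (reflect (suc (j + length t))) (actᴸ⁻¹-asc-bubble p a t |p|) ⟩
  reflect (suc (j + length t)) (p ++ t ++ [ a ])
    ≡⟨ cong (reflect (suc (j + length t))) (++-assoc p t [ a ]) ⟨
  reflect (suc (j + length t)) ((p ++ t) ++ [ a ])
    ≡⟨ reflect-++ (p ++ t) [ a ] (trans (length-++ p) (cong (_+ length t) |p|)) ⟩
  (p ++ t) ++ [ ℤ.- a ]
    ≡⟨ ++-assoc p t _ ⟩
  p ++ t ++ [ ℤ.- a ] ∎
  where W = asc (suc j) (length t)

actᴸ⁻¹-asc-rotate-power : ∀ {j m k} p xs ys → length p ≡ j → length xs ≡ m → length (xs ++ ys) ≡ k →
  actᴸ⁻¹ (concat (replicate m (asc (suc j) k))) (p ++ xs ++ ys) ≡ p ++ ys ++ map ℤ.-_ xs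
actᴸ⁻¹-asc-rotate-power p [] ys _ refl _ = cong (p ++_) (sym (++-identityʳ ys))
actᴸ⁻¹-asc-rotate-power {j} p (x ∷ xs) ys |p| refl refl = begin
  actᴸ⁻¹ (C ++ Cs) (p ++ x ∷ xs ++ ys)      ≡⟨ foldl-++ (flip reflect) _ C Cs ⟩
  actᴸ⁻¹ Cs (actᴸ⁻¹ C (p ++ x ∷ xs ++ ys))  ≡⟨ cong (actᴸ⁻¹ Cs) (actᴸ⁻¹-asc-rotate p x (xs ++ ys) |p|) ⟩
  actᴸ⁻¹ Cs (p ++ (xs ++ ys) ++ [ ℤ.- x ])  ≡⟨ cong (λ l → actᴸ⁻¹ Cs (p ++ l)) (++-assoc xs ys _) ⟩
  actᴸ⁻¹ Cs (p ++ xs ++ ys ++ [ ℤ.- x ])    ≡⟨ actᴸ⁻¹-asc-rotate-power p xs (ys ++ [ ℤ.- x ]) |p| refl |xs++ys++x| ⟩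
  p ++ (ys ++ [ ℤ.- x ]) ++ map ℤ.-_ xs     ≡⟨ cong (p ++_) (++-assoc ys _ _) ⟩
  p ++ ys ++ ℤ.- x ∷ map ℤ.-_ xs            ∎
  where
  C = asc (suc j) (suc (length (xs ++ ys)))
  Cs = concat (replicate (length xs) C)
  |xs++ys++x| = trans (cong length (sym (++-assoc xs ys [ ℤ.- x ]))) (length-∷ʳ (xs ++ ys) _)

actᴸ⁻¹-asc-negate : ∀ {j k} p xs → length p ≡ j → length xs ≡ k →
  actᴸ⁻¹ (concat (replicate k (asc (suc j) k))) (p ++ xs) ≡ p ++ map ℤ.-_ xs
actᴸ⁻¹-asc-negate {j} {k} p xs |p| |xs| = begin
  actᴸ⁻¹ W (p ++ xs)        ≡⟨ cong (λ l → actᴸ⁻¹ W (p ++ l)) (++-identityʳ xs) ⟨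
  actᴸ⁻¹ W (p ++ xs ++ [])  ≡⟨ actᴸ⁻¹-asc-rotate-power p xs [] |p| |xs| (trans (cong length (++-identityʳ xs)) |xs|) ⟩
  p ++ map ℤ.-_ xs          ∎
  where W = concat (replicate k (asc (suc j) k))

actᴸ-asc-forward : ∀ {j} q p b t → length q ≡ j →
  actᴸ (asc (suc j) (length p)) (q ++ p ++ b ∷ t) ≡ q ++ b ∷ p ++ t
actᴸ-asc-forward q [] b t _ = refl
actᴸ-asc-forward {j} q (c ∷ p) b t |q| = begin
  reflect (suc j) (actᴸ W (q ++ c ∷ p ++ b ∷ t))
    ≡⟨ cong (λ l → reflect (suc j) (actᴸ W l)) (++-assoc q [ c ] _) ⟨
  reflect (suc j) (actᴸ W ((q ++ [ c ]) ++ p ++ b ∷ t))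
    ≡⟨ cong (reflect (suc j)) (actᴸ-asc-forward (q ++ [ c ]) p b t (trans (length-∷ʳ q c) (cong suc |q|))) ⟩
  reflect (suc j) ((q ++ [ c ]) ++ b ∷ p ++ t)
    ≡⟨ cong (reflect (suc j)) (++-assoc q [ c ] _) ⟩
  reflect (suc j) (q ++ c ∷ b ∷ p ++ t)
    ≡⟨ reflect-++ q _ |q| ⟩
  q ++ b ∷ c ∷ p ++ t ∎
  where W = asc (suc (suc j)) (length p)

actᴸ-asc-cycle : ∀ {k} p b → length p ≡ k → actᴸ (asc 1 (suc k)) (p ++ [ b ]) ≡ ℤ.- b ∷ p
actᴸ-asc-cycle {k} p b |p| = begin
  actᴸ (asc 1 (suc k)) (p ++ [ b ])              ≡⟨ cong (λ u → actᴸ u (p ++ [ b ])) (asc-∷ʳ 1 k) ⟩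
  actᴸ (asc 1 k ++ [ suc k ]) (p ++ [ b ])       ≡⟨ foldr-++ reflect (p ++ [ b ]) (asc 1 k) _ ⟩
  actᴸ (asc 1 k) (reflect (suc k) (p ++ [ b ]))  ≡⟨ cong (actᴸ (asc 1 k)) (reflect-++ p [ b ] |p|) ⟩
  actᴸ (asc 1 k) (p ++ [ ℤ.- b ])                ≡⟨ cong (λ m → actᴸ (asc 1 m) (p ++ [ ℤ.- b ])) |p| ⟨
  actᴸ (asc 1 (length p)) ([] ++ p ++ [ ℤ.- b ]) ≡⟨ actᴸ-asc-forward [] p (ℤ.- b) [] refl ⟩
  ℤ.- b ∷ p ++ []                                ≡⟨ cong (ℤ.- b ∷_) (++-identityʳ p) ⟩
  ℤ.- b ∷ p                                      ∎

map-neg-involutive : ∀ (l : List ℤ) → map ℤ.-_ (map ℤ.-_ l) ≡ l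
map-neg-involutive l = trans (sym (map-∘ l)) (trans (map-cong neg-involutive l) (map-id l))

actᴸ⁻¹-w₀ : ∀ {n} l → length l ≡ n → actᴸ⁻¹ (w₀ n) l ≡ map ℤ.-_ l
actᴸ⁻¹-w₀ {n} l |l| = trans (cong (λ c → actᴸ⁻¹ (concat (replicate n c)) l) (ascending≡asc 1 n))
                            (actᴸ⁻¹-asc-negate [] l refl |l|)

actᴸ⁻¹-w₀I : ∀ {k} a r → length r ≡ k → actᴸ⁻¹ (w₀I (suc k)) (a ∷ r) ≡ a ∷ map ℤ.-_ r
actᴸ⁻¹-w₀I {k} a r |r| = trans (cong (λ c → actᴸ⁻¹ (concat (replicate k c)) (a ∷ r)) (ascending≡asc 2 (suc k)))
                               (actᴸ⁻¹-asc-negate [ a ] r refl |r|)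

negateHead : List ℤ → List ℤ
negateHead []      = []
negateHead (a ∷ l) = ℤ.- a ∷ l

length-negateHead : ∀ l → length (negateHead l) ≡ length l
length-negateHead []      = refl
length-negateHead (a ∷ l) = refl

actᴸ-z⁻¹ : ∀ {k} l → length l ≡ suc k → actᴸ (inv (zW (suc k))) l ≡ negateHead l
actᴸ-z⁻¹ {k} (a ∷ r) |l| = begin
  actᴸ (inv (w₀I n ++ w₀ n)) (a ∷ r)      ≡⟨ actᴸ-inv (w₀I n ++ w₀ n) (a ∷ r) ⟩
  actᴸ⁻¹ (w₀I n ++ w₀ n) (a ∷ r)          ≡⟨ foldl-++ (flip reflect) (a ∷ r) (w₀I n) (w₀ n) ⟩
  actᴸ⁻¹ (w₀ n) (actᴸ⁻¹ (w₀I n) (a ∷ r))  ≡⟨ cong (actᴸ⁻¹ (w₀ n)) (actᴸ⁻¹-w₀I a r |r|) ⟩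
  actᴸ⁻¹ (w₀ n) (a ∷ map ℤ.-_ r)          ≡⟨ actᴸ⁻¹-w₀ (a ∷ map ℤ.-_ r) (cong suc (trans (length-map ℤ.-_ r) |r|)) ⟩
  ℤ.- a ∷ map ℤ.-_ (map ℤ.-_ r)           ≡⟨ cong (ℤ.- a ∷_) (map-neg-involutive r) ⟩
  ℤ.- a ∷ r                               ∎
  where
  n = suc k
  |r| = ℕ.suc-injective |l|

toList-φ : ∀ k w (v : Char (suc k)) → toList (φ (suc k) w v) ≡ actᴸ w (negateHead (toList v))
toList-φ k w v = begin
  toList (act (suc k) (w ++ z⁻¹) v)  ≡⟨ toList-act (suc k) (w ++ z⁻¹) v ⟩
  actᴸ (w ++ z⁻¹) (toList v)         ≡⟨ foldr-++ reflect (toList v) w z⁻¹ ⟩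
  actᴸ w (actᴸ z⁻¹ (toList v))       ≡⟨ cong (actᴸ w) (actᴸ-z⁻¹ (toList v) (length-toList v)) ⟩
  actᴸ w (negateHead (toList v))     ∎
  where z⁻¹ = inv (zW (suc k))

-- Coordinates are 0-based, whereas roots are indexed from 1 as in the paper.
coord : List ℤ → ℕ → ℤ
coord []      _       = 0ℤ
coord (a ∷ l) zero    = a
coord (a ∷ l) (suc c) = coord l c

coord-++ˡ : ∀ p q {c} → c < length p → coord (p ++ q) c ≡ coord p c
coord-++ˡ (a ∷ p) q {zero}  _         = refl
coord-++ˡ (a ∷ p) q {suc c} (s≤s c<p) = coord-++ˡ p q c<p

coord-negateHead : ∀ l c → coord l c ≡ 0ℤ → coord (negateHead l) c ≡ 0ℤ
coord-negateHead []      c       _       = refl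
coord-negateHead (a ∷ l) zero    a≡0     = cong ℤ.-_ a≡0
coord-negateHead (a ∷ l) (suc c) l[c]≡0  = l[c]≡0

split-at : ∀ j (l : List ℤ) → j < length l → ∃ λ p → ∃ λ b → ∃ λ t → l ≡ p ++ b ∷ t × length p ≡ j
split-at zero    (b ∷ t) _ = [] , b , t , refl , refl
split-at (suc j) (a ∷ l) (s≤s j<l) with split-at j l j<l
... | p , b , t , refl , refl = a ∷ p , b , t , refl , refl

α-zero-prefix : ∀ {n i} c → suc c < i → i ≤ n → ∃ λ t → toList (α n i) ≡ replicate c 0ℤ ++ 0ℤ ∷ t
α-zero-prefix {suc n} {suc zero}    zero (s≤s ()) _
α-zero-prefix {suc n} {suc (suc i)} zero _ _ = toList (α n (suc i)) , cong toList (α-suc n i)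
α-zero-prefix {suc n} {suc (suc i)} (suc c) (s≤s c<i) (s≤s i≤n) with α-zero-prefix c c<i i≤n
... | t , eq = t , trans (cong toList (α-suc n i)) (cong (0ℤ ∷_) eq)

α-head-zero : ∀ {n i} → 2 ≤ i → i ≤ n → coord (toList (α n i)) 0 ≡ 0ℤ
α-head-zero 2≤i i≤n with α-zero-prefix 0 2≤i i≤n
... | t , eq = cong (λ l → coord l 0) eq

α-unit : ∀ {n i} → 1 ≤ i → i ≤ n → coord (toList (α n i)) (i ∸ 1) ≡ 1ℤ
α-unit {suc zero}    {suc zero}    _ _ = refl
α-unit {suc (suc n)} {suc zero}    _ _ = refl
α-unit {suc n}       {suc (suc i)} _ (s≤s i≤n) rewrite α-suc n i = α-unit {n} {suc i} (s≤s z≤n) i≤n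

negateHead-zero-prefix : ∀ j t → negateHead (replicate j 0ℤ ++ 0ℤ ∷ t) ≡ replicate j 0ℤ ++ 0ℤ ∷ t
negateHead-zero-prefix zero    t = refl
negateHead-zero-prefix (suc j) t = refl

replicate-++-∷ : ∀ {A : Set} j (x : A) t → x ∷ replicate j x ++ t ≡ replicate j x ++ x ∷ t
replicate-++-∷ zero    x t = refl
replicate-++-∷ (suc j) x t = cong (x ∷_) (replicate-++-∷ j x t)

iter-fixed : ∀ {A : Set} (f : A → A) {a} → f a ≡ a → ∀ m → iter m f a ≡ a
iter-fixed f fa≡a zero    = refl
iter-fixed f fa≡a (suc m) = trans (cong f (iter-fixed f fa≡a m)) fa≡a

fixed⇒InIw : ∀ {n w i} → InI n i → φ n w (α n i) ≡ α n i → InIw n w i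
fixed⇒InIw {n} {w} {i} i∈I fixed m = i , i∈I , iter-fixed (φ n w) fixed m

module CanonicalType {k j : ℕ} (j≤k : j ≤ k) (w : Word) (σ : ℤ → ℤ) (σ-0 : σ 0ℤ ≡ 0ℤ)
  (w-cycle : ∀ p b t → length p ≡ j → length (p ++ b ∷ t) ≡ suc k → actᴸ w (p ++ b ∷ t) ≡ σ b ∷ p ++ t)
  where

  w-shifts-zero : ∀ l c → length l ≡ suc k → c < j → coord l c ≡ 0ℤ → coord (actᴸ w l) (suc c) ≡ 0ℤ
  w-shifts-zero l c |l| c<j l[c]≡0 with split-at j l (subst (j <_) (sym |l|) (s≤s j≤k))
  ... | p , b , t , refl , |p| rewrite w-cycle p b t |p| |l| = begin
    coord (p ++ t) c      ≡⟨ coord-++ˡ p t c<p ⟩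
    coord p c             ≡⟨ coord-++ˡ p (b ∷ t) c<p ⟨
    coord (p ++ b ∷ t) c  ≡⟨ l[c]≡0 ⟩
    0ℤ                    ∎
    where c<p = subst (c <_) (sym |p|) c<j

  φ-shifts-zero : ∀ v c → c < j → coord (toList v) c ≡ 0ℤ → coord (toList (φ (suc k) w v)) (suc c) ≡ 0ℤ
  φ-shifts-zero v c c<j v[c]≡0 rewrite toList-φ k w v =
    w-shifts-zero (negateHead (toList v)) c (trans (length-negateHead (toList v)) (length-toList v)) c<j
                  (coord-negateHead (toList v) c v[c]≡0)

  iter-φ-zero : ∀ m v → m ≤ j → coord (toList v) 0 ≡ 0ℤ → coord (toList (iter m (φ (suc k) w) v)) m ≡ 0ℤ
  iter-φ-zero zero    v _   v[0]≡0 = v[0]≡0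
  iter-φ-zero (suc m) v m<j v[0]≡0 =
    φ-shifts-zero (iter m (φ (suc k) w) v) m m<j (iter-φ-zero m v (ℕ.<⇒≤ m<j) v[0]≡0)

  φ-fixes-zero-prefix : ∀ t → length (replicate j 0ℤ ++ 0ℤ ∷ t) ≡ suc k →
    actᴸ w (negateHead (replicate j 0ℤ ++ 0ℤ ∷ t)) ≡ replicate j 0ℤ ++ 0ℤ ∷ t
  φ-fixes-zero-prefix t |l| = begin
    actᴸ w (negateHead (replicate j 0ℤ ++ 0ℤ ∷ t)) ≡⟨ cong (actᴸ w) (negateHead-zero-prefix j t) ⟩
    actᴸ w (replicate j 0ℤ ++ 0ℤ ∷ t)              ≡⟨ w-cycle (replicate j 0ℤ) 0ℤ t (length-replicate j) |l| ⟩
    σ 0ℤ ∷ replicate j 0ℤ ++ t                     ≡⟨ cong (_∷ replicate j 0ℤ ++ t) σ-0 ⟩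
    0ℤ ∷ replicate j 0ℤ ++ t                       ≡⟨ replicate-++-∷ j 0ℤ t ⟩
    replicate j 0ℤ ++ 0ℤ ∷ t                       ∎

  φ-fixes-α : ∀ i → suc j < i → i ≤ suc k → φ (suc k) w (α (suc k) i) ≡ α (suc k) i
  φ-fixes-α i j<i i≤n with α-zero-prefix j j<i i≤n
  ... | t , eq = trans (sym (cast-is-id refl _)) (toList-injective refl _ _ (begin
    toList (φ (suc k) w (α (suc k) i))              ≡⟨ toList-φ k w (α (suc k) i) ⟩
    actᴸ w (negateHead (toList (α (suc k) i)))      ≡⟨ cong (actᴸ w ∘ negateHead) eq ⟩
    actᴸ w (negateHead (replicate j 0ℤ ++ 0ℤ ∷ t))  ≡⟨ φ-fixes-zero-prefix t |l| ⟩
    replicate j 0ℤ ++ 0ℤ ∷ t                        ≡⟨ eq ⟨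
    toList (α (suc k) i)                            ∎))
    where |l| = trans (cong length (sym eq)) (length-toList (α (suc k) i))

  canonical-type : ∀ i → 1 ≤ i → i ≤ suc k → InIw (suc k) w i ⇔ j + 1 < i
  canonical-type (suc i) _ i<n = mk⇔ to from
    where
    j+1≡1+j = ℕ.+-comm j 1

    from : j + 1 < suc i → InIw (suc k) w (suc i)
    from j+1<i = fixed⇒InIw {w = w} (ℕ.≤-trans (s≤s (s≤s z≤n)) j<i , i<n) (φ-fixes-α (suc i) j<i i<n)
      where j<i = subst (_< suc i) j+1≡1+j j+1<i

    to : InIw (suc k) w (suc i) → j + 1 < suc i
    to inIw with j + 1 ℕ.<? suc i
    ... | yes j+1<i = j+1<i
    ... | no j+1≮i with inIw i
    ...   | l , (2≤l , l≤n) , φⁱαₗ≡αᵢ = ⊥-elim (1≢0 (trans (sym (α-unit (s≤s z≤n) i<n)) αᵢ[i]≡0))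
      where
      i≤j = ℕ.≤-pred (subst (suc i ≤_) j+1≡1+j (ℕ.≮⇒≥ j+1≮i))
      αᵢ[i]≡0 : coord (toList (α (suc k) (suc i))) i ≡ 0ℤ
      αᵢ[i]≡0 = subst (λ v → coord (toList v) i ≡ 0ℤ) φⁱαₗ≡αᵢ
                      (iter-φ-zero i (α (suc k) l) i≤j (α-head-zero 2≤l l≤n))
      1≢0 : 1ℤ ≢ 0ℤ
      1≢0 ()

x-below : ∀ {n j} → suc j < n → x n j ≡ ascending 1 n ++ descending (suc j) (n ∸ 1)
x-below {n} {j} j<n rewrite dec-true (suc j ℕ.<? n) j<n = refl

x-not-below : ∀ {n j} → ¬ suc j < n → x n j ≡ ascending 1 (2 * n ∸ 1 ∸ j)
x-not-below {n} {j} j≮n rewrite dec-false (suc j ℕ.<? n) j≮n = refl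

-- This includes j = n-1, where the descending part is empty.
x-low : ∀ {k j} → j ≤ k → x (suc k) j ≡ ascending 1 (suc k) ++ descending (suc j) k
x-low {k} {j} j≤k with ℕ.m≤n⇒m<n∨m≡n j≤k
... | inj₁ j<k = x-below (s≤s j<k)
... | inj₂ refl rewrite x-not-below {suc k} {k} (ℕ.<-irrefl refl) | ℕ.n∸n≡0 k
                      | ++-identityʳ (ascending 1 (suc k)) =
  cong (ascending 1) (trans (ℕ.m+n∸m≡n k _) (cong suc (ℕ.+-identityʳ k)))

x-high : ∀ {k j} → j ≤ k → x (suc k) (2 * suc k ∸ 1 ∸ j) ≡ ascending 1 j
x-high {k} {j} j≤k = trans (x-not-below (ℕ.≤⇒≯ (s≤s k≤y))) (cong (ascending 1) (ℕ.m∸[m∸n]≡n j≤2k+1))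
  where
  j≤2k+1 : j ≤ k + suc (k + 0)
  j≤2k+1 = ℕ.≤-trans j≤k (ℕ.m≤m+n k _)
  k≤y : k ≤ k + suc (k + 0) ∸ j
  k≤y = ℕ.≤-trans (ℕ.m≤n⇒m≤1+n (ℕ.m≤m+n k 0))
          (ℕ.≤-trans (ℕ.m≤n+m _ (k ∸ j)) (ℕ.≤-reflexive (sym (ℕ.+-∸-comm _ j≤k))))

length-suffix : ∀ {k j} p (b : ℤ) t → length p ≡ j → length (p ++ b ∷ t) ≡ suc k → length t ≡ k ∸ j
length-suffix {k} {j} p b t |p| |l| = begin
  length t          ≡⟨ ℕ.m+n∸m≡n j (length t) ⟨
  j + length t ∸ j  ≡⟨ cong (_∸ j) j+|t|≡k ⟩
  k ∸ j             ∎
  where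
  j+|t|≡k : j + length t ≡ k
  j+|t|≡k = ℕ.suc-injective (begin
    suc (j + length t)         ≡⟨ ℕ.+-suc j (length t) ⟨
    j + suc (length t)         ≡⟨ cong (_+ suc (length t)) |p| ⟨
    length p + length (b ∷ t)  ≡⟨ length-++ p ⟨
    length (p ++ b ∷ t)        ≡⟨ |l| ⟩
    suc k                      ∎)

actᴸ-x-low : ∀ {k j} → j ≤ k → ∀ p b t → length p ≡ j → length (p ++ b ∷ t) ≡ suc k →
  actᴸ (x (suc k) j) (p ++ b ∷ t) ≡ ℤ.- b ∷ p ++ t
actᴸ-x-low {k} {j} j≤k p b t |p| |l| = begin
  actᴸ (x (suc k) j) (p ++ b ∷ t)      ≡⟨ cong (λ u → actᴸ u (p ++ b ∷ t)) (x-low j≤k) ⟩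
  actᴸ (A ++ inv D) (p ++ b ∷ t)       ≡⟨ foldr-++ reflect (p ++ b ∷ t) A (inv D) ⟩
  actᴸ A (actᴸ (inv D) (p ++ b ∷ t))   ≡⟨ cong (actᴸ A) (actᴸ-inv D (p ++ b ∷ t)) ⟩
  actᴸ A (actᴸ⁻¹ D (p ++ b ∷ t))       ≡⟨ cong (λ u → actᴸ A (actᴸ⁻¹ u (p ++ b ∷ t))) D≡asc ⟩
  actᴸ A (actᴸ⁻¹ (asc (suc j) (length t)) (p ++ b ∷ t))
                                       ≡⟨ cong (actᴸ A) (actᴸ⁻¹-asc-bubble p b t |p|) ⟩
  actᴸ A (p ++ t ++ [ b ])             ≡⟨ cong₂ actᴸ (ascending≡asc 1 (suc k)) (sym (++-assoc p t [ b ])) ⟩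
  actᴸ (asc 1 (suc k)) ((p ++ t) ++ [ b ])
                                       ≡⟨ actᴸ-asc-cycle (p ++ t) b |p++t| ⟩
  ℤ.- b ∷ p ++ t                       ∎
  where
  A = ascending 1 (suc k)
  D = ascending (suc j) k
  |t| = length-suffix p b t |p| |l|
  D≡asc = trans (ascending≡asc (suc j) k) (cong (asc (suc j)) (sym |t|))
  |p++t| = trans (length-++ p) (trans (cong₂ _+_ |p| |t|) (ℕ.m+[n∸m]≡n j≤k))

actᴸ-x-high : ∀ {k j} → j ≤ k → ∀ p b t → length p ≡ j →
  actᴸ (x (suc k) (2 * suc k ∸ 1 ∸ j)) (p ++ b ∷ t) ≡ b ∷ p ++ t
actᴸ-x-high {k} {j} j≤k p b t |p| = begin
  actᴸ (x (suc k) (2 * suc k ∸ 1 ∸ j)) (p ++ b ∷ t)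
    ≡⟨ cong (λ u → actᴸ u (p ++ b ∷ t)) (trans (x-high j≤k) (ascending≡asc 1 j)) ⟩
  actᴸ (asc 1 j) (p ++ b ∷ t)
    ≡⟨ cong (λ m → actᴸ (asc 1 m) (p ++ b ∷ t)) |p| ⟨
  actᴸ (asc 1 (length p)) ([] ++ p ++ b ∷ t)
    ≡⟨ actᴸ-asc-forward [] p b t refl ⟩
  b ∷ p ++ t ∎

proposition6p2 : (n : ℕ) → 1 ≤ n → (j : ℕ) → j ≤ n ∸ 1 → (i : ℕ) → 1 ≤ i → i ≤ n →
    (InIw n (x n j) i ⇔ j + 1 < i) × (InIw n (x n ((2 * n ∸ 1) ∸ j)) i ⇔ j + 1 < i)
proposition6p2 (suc k) _ j j≤k i 1≤i i≤n =
  CanonicalType.canonical-type j≤k (x (suc k) j) ℤ.-_ refl (actᴸ-x-low j≤k) i 1≤i i≤n ,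
  CanonicalType.canonical-type j≤k (x (suc k) (2 * suc k ∸ 1 ∸ j)) (λ b → b) refl
    (λ p b t |p| _ → actᴸ-x-high j≤k p b t |p|) i 1≤i i≤n
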